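{- Let $N=\{1,\ldots,n\}$ and let $\mathcal{Q}(N)=\{(A,B)\in 2^N\times 2^N : A\cap B=\emptyset\}$, partially ordered by $(A,B)\sqsubseteq(C,D)$ iff $A\subseteq C$ and $B\supseteq D$. Then the M\"obius function $\mu$ of the poset $(\mathcal{Q}(N),\sqsubseteq)$ is given, for all $(A,A'),(B,B')\in\mathcal{Q}(N)$, by \[ \mu((A,A'),(B,B'))=\begin{cases}(-1)^{|B\setminus A|+|A'\setminus B'|}, & \text{if } (A,A')\sqsubseteq(B,B') \text{ and } A'\cap B=\emptyset,\\ 0, & \text{otherwise.}\end{cases} \]
   Context: For a finite poset $(X,\leq)$, the M\"obius function $\mu:X\times X\to\mathbb{Z}$ is defined inductively by $\mu(x,x)=1$, $\mu(x,y)=-\sum_{x\leq t<y}\mu(x,t)$ if $x<y$, and $\mu(x,y)=0$ otherwise. -}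

module Defs where

open import Data.Nat using (ℕ; zero; suc)
open import Data.Bool using (Bool; true; false)
import Data.Bool.Properties as BoolP
open import Data.Integer using (ℤ; +_; -_)
import Data.Integer as ℤ
open import Data.List using (List; []; _∷_; map; filter; length; concatMap)
open import Data.Vec using (Vec; []; _∷_)
open import Data.Vec.Properties using (≡-dec)
open import Data.Fin.Subset using (Subset; _⊆_; _∩_; ⊥)
open import Data.Fin.Subset.Properties using (_⊆?_)
open import Data.Product using (_×_; _,_; proj₁; proj₂)
open import Relation.Nullary using (¬_; Dec; yes; no)
open import Relation.Nullary.Decidable using (_×-dec_; ¬?)
open import Relation.Binary.PropositionalEquality using (_≡_)

Disjoint : ∀ {n} → Subset n → Subset n → Set
Disjoint A B = A ∩ B ≡ ⊥

Disjoint? : ∀ {n} (A B : Subset n) → Dec (Disjoint A B)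
Disjoint? A B = ≡-dec BoolP._≟_ (A ∩ B) ⊥

Pair : ℕ → Set
Pair n = Subset n × Subset n

_≟P_ : ∀ {n} (x y : Pair n) → Dec (x ≡ y)
(A , B) ≟P (C , D) with ≡-dec BoolP._≟_ A C | ≡-dec BoolP._≟_ B D
... | yes Relation.Binary.PropositionalEquality.refl | yes Relation.Binary.PropositionalEquality.refl = yes Relation.Binary.PropositionalEquality.refl
... | no ¬p | _ = no λ { Relation.Binary.PropositionalEquality.refl → ¬p Relation.Binary.PropositionalEquality.refl }
... | yes _ | no ¬q = no λ { Relation.Binary.PropositionalEquality.refl → ¬q Relation.Binary.PropositionalEquality.refl }

_⊑_ : ∀ {n} → Pair n → Pair n → Set
(A , B) ⊑ (C , D) = A ⊆ C × D ⊆ B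

_⊑?_ : ∀ {n} (x y : Pair n) → Dec (x ⊑ y)
(A , B) ⊑? (C , D) = (A ⊆? C) ×-dec (D ⊆? B)

_⊏_ : ∀ {n} → Pair n → Pair n → Set
x ⊏ y = x ⊑ y × ¬ (x ≡ y)

_⊏?_ : ∀ {n} (x y : Pair n) → Dec (x ⊏ y)
x ⊏? y = (x ⊑? y) ×-dec ¬? (x ≟P y)

allSubsets : (n : ℕ) → List (Subset n)
allSubsets zero = [] ∷ []
allSubsets (suc n) = concatMap (λ s → (false ∷ s) ∷ (true ∷ s) ∷ []) (allSubsets n)

allPairs : (n : ℕ) → List (Pair n)
allPairs n = concatMap (λ A → map (λ B → (A , B)) (allSubsets n)) (allSubsets n)

Q : (n : ℕ) → List (Pair n)
Q n = filter (λ p → Disjoint? (proj₁ p) (proj₂ p)) (allPairs n)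

sumℤ : List ℤ → ℤ
sumℤ [] = + 0
sumℤ (x ∷ xs) = x ℤ.+ sumℤ xs

-- Each recursive call strictly shortens the interval, so fuel |Q(N)| is
-- always sufficient (the fuel-0 clause is never reached from mobius below).
mobiusFuel : ∀ {n} → ℕ → Pair n → Pair n → ℤ
mobiusFuel zero x y = + 0
mobiusFuel {n} (suc k) x y with x ≟P y | x ⊑? y
... | yes _ | _ = + 1
... | no _ | yes _ = - sumℤ (map (mobiusFuel k x)
                            (filter (λ t → (x ⊑? t) ×-dec (t ⊏? y)) (Q n)))
... | no _ | no _ = + 0

mobius : ∀ {n} → Pair n → Pair n → ℤ
mobius {n} = mobiusFuel (length (Q n))

module Submission where

open import Defs
open import Data.Nat using (ℕ; zero; suc; _≤_; _<_; z≤n; s≤s; s≤s⁻¹)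
import Data.Nat as ℕ
import Data.Nat.Properties as ℕP
open import Data.Integer using (ℤ; +_; -_; _^_; _+_; _*_; _-_)
import Data.Integer.Properties as ℤP
open import Data.Integer.Tactic.RingSolver using (solve-∀)
open import Data.Bool using (Bool; true; false; not; _∧_; _∨_; _xor_)
import Data.Bool.Properties as BoolP
open import Algebra.Bundles using (CommutativeMonoid)
open import Algebra.Properties.CommutativeSemigroup ℤP.+-commutativeSemigroup
  using () renaming (interchange to +-interchange)
open import Algebra.Properties.CommutativeSemigroup ℕP.+-commutativeSemigroup
  using () renaming (interchange to ℕ-+-interchange)
open import Algebra.Properties.CommutativeSemigroup
  (CommutativeMonoid.commutativeSemigroup BoolP.∧-commutativeMonoid)
  using () renaming (interchange to ∧-interchange)
open import Data.List using (List; []; _∷_; map; filter; length; concatMap; _++_)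
open import Data.List.Membership.Propositional using (_∈_)
open import Data.List.Membership.Propositional.Properties using (∈-filter⁻)
import Data.List.Relation.Unary.Any as Any
open import Data.Vec using ([]; _∷_; here; there)
open import Data.Vec.Properties using (∷-injective)
open import Data.Fin.Subset using (Subset; _─_; ∣_∣; _⊆_)
open import Data.Fin.Subset.Properties using (drop-∷-⊆)
open import Data.Product using (_×_; _,_; proj₁; proj₂)
open import Data.Empty using (⊥-elim)
open import Relation.Nullary using (¬_; Dec; yes; no; does)
open import Relation.Nullary.Decidable using (_×-dec_; dec-true; dec-false)
open import Relation.Unary using (Pred; Decidable)
open import Relation.Binary.PropositionalEquality
  using (_≡_; refl; sym; trans; cong; cong₂; module ≡-Reasoning)

-- Coordinatewise, a pair (A , A′) of disjoint subsets of N is a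
-- word over the three "states" (0,1) ⊏ (0,0) ⊏ (1,0) of a coordinate, and ⊑ is
-- the coordinatewise order, so Q(N) is the n-th power of a 3-element chain.
-- Hence its Möbius function is the product μΠ of the Möbius functions μ₁ of
-- that chain (1 on the diagonal, -1 on a cover, 0 otherwise).

sumMap : ∀ {a} {A : Set a} → (A → ℤ) → List A → ℤ
sumMap f xs = sumℤ (map f xs)

sumMap-++ : ∀ {a} {A : Set a} (f : A → ℤ) xs ys →
  sumMap f (xs ++ ys) ≡ sumMap f xs + sumMap f ys
sumMap-++ f [] ys = sym (ℤP.+-identityˡ _)
sumMap-++ f (x ∷ xs) ys = trans (cong (λ z → f x + z) (sumMap-++ f xs ys)) (sym (ℤP.+-assoc (f x) _ _))

sumMap-concatMap : ∀ {a b} {A : Set a} {B : Set b} (h : B → ℤ) (f : A → List B) xs →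
  sumMap h (concatMap f xs) ≡ sumMap (λ x → sumMap h (f x)) xs
sumMap-concatMap h f [] = refl
sumMap-concatMap h f (x ∷ xs) =
  trans (sumMap-++ h (f x) (concatMap f xs)) (cong (λ z → sumMap h (f x) + z) (sumMap-concatMap h f xs))

sumMap-map : ∀ {a b} {A : Set a} {B : Set b} (h : B → ℤ) (f : A → B) xs →
  sumMap h (map f xs) ≡ sumMap (λ x → h (f x)) xs
sumMap-map h f [] = refl
sumMap-map h f (x ∷ xs) = cong (λ z → h (f x) + z) (sumMap-map h f xs)

sumMap-cong-∈ : ∀ {a} {A : Set a} {f g : A → ℤ} xs →
  (∀ t → t ∈ xs → f t ≡ g t) → sumMap f xs ≡ sumMap g xs
sumMap-cong-∈ [] e = refl
sumMap-cong-∈ (x ∷ xs) e = cong₂ _+_ (e x (Any.here refl)) (sumMap-cong-∈ xs (λ t m → e t (Any.there m)))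

sumMap-cong : ∀ {a} {A : Set a} {f g : A → ℤ} xs → (∀ t → f t ≡ g t) → sumMap f xs ≡ sumMap g xs
sumMap-cong xs e = sumMap-cong-∈ xs (λ t _ → e t)

sumMap-+ : ∀ {a} {A : Set a} (f g : A → ℤ) xs →
  sumMap (λ t → f t + g t) xs ≡ sumMap f xs + sumMap g xs
sumMap-+ f g [] = refl
sumMap-+ f g (x ∷ xs) =
  trans (cong (λ z → (f x + g x) + z) (sumMap-+ f g xs)) (+-interchange (f x) (g x) (sumMap f xs) (sumMap g xs))

sumMap-─ : ∀ {a} {A : Set a} (f g : A → ℤ) xs →
  sumMap (λ t → f t - g t) xs ≡ sumMap f xs - sumMap g xs
sumMap-─ f g [] = refl
sumMap-─ f g (x ∷ xs) =
  trans (cong (λ z → (f x - g x) + z) (sumMap-─ f g xs)) (regroup (f x) (g x) (sumMap f xs) (sumMap g xs))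
  where
  regroup : ∀ a b c d → (a - b) + (c - d) ≡ (a + c) - (b + d)
  regroup = solve-∀

sumMap-* : ∀ {a} {A : Set a} (c : ℤ) (f : A → ℤ) xs → sumMap (λ t → c * f t) xs ≡ c * sumMap f xs
sumMap-* c f [] = sym (ℤP.*-zeroʳ c)
sumMap-* c f (x ∷ xs) = trans (cong (λ z → c * f x + z) (sumMap-* c f xs)) (sym (ℤP.*-distribˡ-+ c (f x) _))

𝟙 : Bool → ℤ
𝟙 true = + 1
𝟙 false = + 0

𝟙-∧ : ∀ p q → 𝟙 (p ∧ q) ≡ 𝟙 p * 𝟙 q
𝟙-∧ true q = sym (ℤP.*-identityˡ (𝟙 q))
𝟙-∧ false q = refl

sumMap-filter : ∀ {a p} {A : Set a} {P : Pred A p} (P? : Decidable P) (g : A → ℤ) xs →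
  sumMap g (filter P? xs) ≡ sumMap (λ t → 𝟙 (does (P? t)) * g t) xs
sumMap-filter P? g [] = refl
sumMap-filter P? g (x ∷ xs) with does (P? x)
... | false = trans (sumMap-filter P? g xs) (sym (ℤP.+-identityˡ _))
... | true = cong₂ _+_ (sym (ℤP.*-identityˡ (g x))) (sumMap-filter P? g xs)

sumMap-one : ∀ {a} {A : Set a} (xs : List A) → sumMap (λ _ → + 1) xs ≡ + length xs
sumMap-one [] = refl
sumMap-one (x ∷ xs) = cong (λ z → + 1 + z) (sumMap-one xs)

does-≡ : ∀ {p} {P : Set p} (d : Dec P) (b : Bool) → (P → b ≡ true) → (b ≡ true → P) → does d ≡ b
does-≡ d true _ sound = dec-true d (sound refl)
does-≡ d false complete _ = dec-false d (λ p → absurd (complete p))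
  where
  absurd : false ≡ true → _
  absurd ()

∧-true : ∀ {p q : Bool} → p ∧ q ≡ true → p ≡ true × q ≡ true
∧-true {true} {true} e = refl , refl

∧-intro : ∀ {p q : Bool} → p ≡ true → q ≡ true → p ∧ q ≡ true
∧-intro refl refl = refl

false-of : ∀ {p} {P : Set p} (b : Bool) → (b ≡ true → P) → ¬ P → b ≡ false
false-of true sound ¬P = ⊥-elim (¬P (sound refl))
false-of false sound ¬P = refl

cons : ∀ {n} → Bool → Bool → Pair n → Pair (suc n)
cons a a′ (A , A′) = (a ∷ A , a′ ∷ A′)

_⇒ᵇ_ : Bool → Bool → Bool
a ⇒ᵇ c = not a ∨ c

_≡ᵇ_ : Bool → Bool → Bool
a ≡ᵇ c = not (a xor c)

le₁ : Bool → Bool → Bool → Bool → Bool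
le₁ a a′ c c′ = (a ⇒ᵇ c) ∧ (c′ ⇒ᵇ a′)

eq₁ : Bool → Bool → Bool → Bool → Bool
eq₁ a a′ c c′ = (a ≡ᵇ c) ∧ (a′ ≡ᵇ c′)

disjointᵇ : ∀ {n} → Subset n → Subset n → Bool
disjointᵇ [] [] = true
disjointᵇ (a ∷ A) (b ∷ B) = not (a ∧ b) ∧ disjointᵇ A B

leᵇ : ∀ {n} → Pair n → Pair n → Bool
leᵇ ([] , []) ([] , []) = true
leᵇ (a ∷ A , a′ ∷ A′) (c ∷ C , c′ ∷ C′) = le₁ a a′ c c′ ∧ leᵇ (A , A′) (C , C′)

eqᵇ : ∀ {n} → Pair n → Pair n → Bool
eqᵇ ([] , []) ([] , []) = true
eqᵇ (a ∷ A , a′ ∷ A′) (c ∷ C , c′ ∷ C′) = eq₁ a a′ c c′ ∧ eqᵇ (A , A′) (C , C′)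

validᵇ : ∀ {n} → Pair n → Bool
validᵇ (A , A′) = disjointᵇ A A′

disjointᵇ-sound : ∀ {n} (A B : Subset n) → disjointᵇ A B ≡ true → Disjoint A B
disjointᵇ-sound [] [] _ = refl
disjointᵇ-sound (a ∷ A) (b ∷ B) e with ∧-true {not (a ∧ b)} e
... | head , tail = cong₂ _∷_ (not-true (a ∧ b) head) (disjointᵇ-sound A B tail)
  where
  not-true : ∀ p → not p ≡ true → p ≡ false
  not-true false _ = refl

disjointᵇ-complete : ∀ {n} (A B : Subset n) → Disjoint A B → disjointᵇ A B ≡ true
disjointᵇ-complete [] [] _ = refl
disjointᵇ-complete (a ∷ A) (b ∷ B) e with ∷-injective e
... | head , tail rewrite head = disjointᵇ-complete A B tail

⊆-∷ : ∀ {n a c} {A C : Subset n} → (a ≡ true → c ≡ true) → A ⊆ C → (a ∷ A) ⊆ (c ∷ C)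
⊆-∷ f A⊆C here with f refl
... | refl = here
⊆-∷ f A⊆C (there p) = there (A⊆C p)

⊆-head : ∀ {n a c} {A C : Subset n} → (a ∷ A) ⊆ (c ∷ C) → a ≡ true → c ≡ true
⊆-head A⊆C refl with A⊆C here
... | here = refl

⇒ᵇ-sound : ∀ a c → a ⇒ᵇ c ≡ true → a ≡ true → c ≡ true
⇒ᵇ-sound true true _ _ = refl

⇒ᵇ-complete : ∀ a c → (a ≡ true → c ≡ true) → a ⇒ᵇ c ≡ true
⇒ᵇ-complete true c f = f refl
⇒ᵇ-complete false c f = refl

leᵇ-sound : ∀ {n} (x y : Pair n) → leᵇ x y ≡ true → x ⊑ y
leᵇ-sound ([] , []) ([] , []) _ = (λ ()) , (λ ())
leᵇ-sound (a ∷ A , a′ ∷ A′) (c ∷ C , c′ ∷ C′) e with ∧-true {le₁ a a′ c c′} e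
... | head , tail with ∧-true {a ⇒ᵇ c} head | leᵇ-sound (A , A′) (C , C′) tail
... | first , second | A⊆C , C′⊆A′ =
  ⊆-∷ (⇒ᵇ-sound a c first) A⊆C , ⊆-∷ (⇒ᵇ-sound c′ a′ second) C′⊆A′

leᵇ-complete : ∀ {n} (x y : Pair n) → x ⊑ y → leᵇ x y ≡ true
leᵇ-complete ([] , []) ([] , []) _ = refl
leᵇ-complete (a ∷ A , a′ ∷ A′) (c ∷ C , c′ ∷ C′) (A⊆C , C′⊆A′) =
  ∧-intro (∧-intro (⇒ᵇ-complete a c (⊆-head A⊆C)) (⇒ᵇ-complete c′ a′ (⊆-head C′⊆A′)))
          (leᵇ-complete (A , A′) (C , C′) (drop-∷-⊆ A⊆C , drop-∷-⊆ C′⊆A′))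

≡ᵇ-sound : ∀ a c → a ≡ᵇ c ≡ true → a ≡ c
≡ᵇ-sound true true _ = refl
≡ᵇ-sound false false _ = refl

eqᵇ-sound : ∀ {n} (x y : Pair n) → eqᵇ x y ≡ true → x ≡ y
eqᵇ-sound ([] , []) ([] , []) _ = refl
eqᵇ-sound (a ∷ A , a′ ∷ A′) (c ∷ C , c′ ∷ C′) e with ∧-true {eq₁ a a′ c c′} e
... | head , tail with ∧-true {a ≡ᵇ c} head | eqᵇ-sound (A , A′) (C , C′) tail
... | first , second | refl rewrite ≡ᵇ-sound a c first | ≡ᵇ-sound a′ c′ second = refl

eqᵇ-refl : ∀ {n} (x : Pair n) → eqᵇ x x ≡ true
eqᵇ-refl ([] , []) = refl
eqᵇ-refl (a ∷ A , a′ ∷ A′) = ∧-intro (∧-intro (diag a) (diag a′)) (eqᵇ-refl (A , A′))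
  where
  diag : ∀ b → b ≡ᵇ b ≡ true
  diag true = refl
  diag false = refl

does-Disjoint? : ∀ {n} (A B : Subset n) → does (Disjoint? A B) ≡ disjointᵇ A B
does-Disjoint? A B = does-≡ (Disjoint? A B) _ (disjointᵇ-complete A B) (disjointᵇ-sound A B)

does-⊑? : ∀ {n} (x y : Pair n) → does (x ⊑? y) ≡ leᵇ x y
does-⊑? x y = does-≡ (x ⊑? y) _ (leᵇ-complete x y) (leᵇ-sound x y)

does-≟P : ∀ {n} (x y : Pair n) → does (x ≟P y) ≡ eqᵇ x y
does-≟P x y = does-≡ (x ≟P y) _ (λ { refl → eqᵇ-refl x }) (eqᵇ-sound x y)

-- Enumerating Q(N) one coordinate at a time

sum-Q : ∀ n (h : Pair n → ℤ) → sumMap h (Q n) ≡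
  sumMap (λ A → sumMap (λ B → 𝟙 (disjointᵇ A B) * h (A , B)) (allSubsets n)) (allSubsets n)
sum-Q n h = begin
  sumMap h (Q n)
    ≡⟨ sumMap-filter (λ p → Disjoint? (proj₁ p) (proj₂ p)) h (allPairs n) ⟩
  sumMap (λ t → 𝟙 (does (Disjoint? (proj₁ t) (proj₂ t))) * h t) (allPairs n)
    ≡⟨ sumMap-cong (allPairs n) (λ t → cong (λ b → 𝟙 b * h t) (does-Disjoint? (proj₁ t) (proj₂ t))) ⟩
  sumMap (λ t → 𝟙 (validᵇ t) * h t) (allPairs n)
    ≡⟨ sumMap-concatMap _ (λ A → map (A ,_) S) S ⟩
  sumMap (λ A → sumMap (λ t → 𝟙 (validᵇ t) * h t) (map (A ,_) S)) S
    ≡⟨ sumMap-cong S (λ A → sumMap-map _ (A ,_) S) ⟩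
  sumMap (λ A → sumMap (λ B → 𝟙 (disjointᵇ A B) * h (A , B)) S) S ∎
  where
  open ≡-Reasoning
  S = allSubsets n

sum-allSubsets-suc : ∀ n (f : Subset (suc n) → ℤ) →
  sumMap f (allSubsets (suc n)) ≡ sumMap (λ s → f (false ∷ s) + f (true ∷ s)) (allSubsets n)
sum-allSubsets-suc n f =
  trans (sumMap-concatMap f (λ s → (false ∷ s) ∷ (true ∷ s) ∷ []) (allSubsets n))
        (sumMap-cong (allSubsets n) (λ s → cong (λ z → f (false ∷ s) + z) (ℤP.+-identityʳ _)))

-- A sum over Q(N ∪ {new}) splits according to the state (0,0), (0,1) or (1,0)
-- of the new point; the state (1,1) is excluded by disjointness.
sum-Q-suc : ∀ n (h : Pair (suc n) → ℤ) → sumMap h (Q (suc n)) ≡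
  (sumMap (λ t → h (cons false false t)) (Q n) + sumMap (λ t → h (cons false true t)) (Q n))
    + sumMap (λ t → h (cons true false t)) (Q n)
sum-Q-suc n h = begin
  sumMap h (Q (suc n))
    ≡⟨ sum-Q (suc n) h ⟩
  sumMap (λ A → sumMap (g A) S′) S′
    ≡⟨ sum-allSubsets-suc n _ ⟩
  sumMap (λ A → sumMap (g (false ∷ A)) S′ + sumMap (g (true ∷ A)) S′) S
    ≡⟨ sumMap-cong S (λ A → cong₂ _+_ (sum-allSubsets-suc n (g (false ∷ A)))
                                      (sum-allSubsets-suc n (g (true ∷ A)))) ⟩
  sumMap (λ A → sumMap (λ B → g₀₀ A B + g₀₁ A B) S + sumMap (λ B → g₁₀ A B + g (true ∷ A) (true ∷ B)) S) S
    ≡⟨ sumMap-cong S (λ A → cong₂ _+_ (sumMap-+ (g₀₀ A) (g₀₁ A) S)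
                                      (sumMap-cong S (λ B → drop-g₁₁ A B))) ⟩
  sumMap (λ A → (sumMap (g₀₀ A) S + sumMap (g₀₁ A) S) + sumMap (g₁₀ A) S) S
    ≡⟨ sumMap-+ _ _ S ⟩
  sumMap (λ A → sumMap (g₀₀ A) S + sumMap (g₀₁ A) S) S + sumMap (λ A → sumMap (g₁₀ A) S) S
    ≡⟨ cong (λ z → z + sumMap (λ A → sumMap (g₁₀ A) S) S) (sumMap-+ _ _ S) ⟩
  (sumMap (λ A → sumMap (g₀₀ A) S) S + sumMap (λ A → sumMap (g₀₁ A) S) S) + sumMap (λ A → sumMap (g₁₀ A) S) S
    ≡⟨ sym (cong₂ _+_ (cong₂ _+_ (sum-Q n _) (sum-Q n _)) (sum-Q n _)) ⟩
  (sumMap (λ t → h (cons false false t)) (Q n) + sumMap (λ t → h (cons false true t)) (Q n))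
    + sumMap (λ t → h (cons true false t)) (Q n) ∎
  where
  open ≡-Reasoning
  S = allSubsets n
  S′ = allSubsets (suc n)
  g : Subset (suc n) → Subset (suc n) → ℤ
  g A B = 𝟙 (disjointᵇ A B) * h (A , B)
  g₀₀ g₀₁ g₁₀ : Subset n → Subset n → ℤ
  g₀₀ A B = g (false ∷ A) (false ∷ B)
  g₀₁ A B = g (false ∷ A) (true ∷ B)
  g₁₀ A B = g (true ∷ A) (false ∷ B)
  drop-g₁₁ : ∀ A B → g₁₀ A B + g (true ∷ A) (true ∷ B) ≡ g₁₀ A B
  drop-g₁₁ A B = trans (cong (λ z → g₁₀ A B + z) (ℤP.*-zeroˡ (h (true ∷ A , true ∷ B))))
                       (ℤP.+-identityʳ _)

triple : ∀ t → (t ℕ.+ t) ℕ.+ t ≡ 3 ℕ.* t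
triple t = trans (ℕP.+-comm (t ℕ.+ t) t) (cong (λ z → t ℕ.+ (t ℕ.+ z)) (sym (ℕP.+-identityʳ t)))

length-Q : ∀ n → length (Q n) ≡ 3 ℕ.^ n
length-Q zero = refl
length-Q (suc n) = ℤP.+-injective (begin
  + length (Q (suc n))
    ≡⟨ sym (sumMap-one (Q (suc n))) ⟩
  sumMap (λ _ → + 1) (Q (suc n))
    ≡⟨ sum-Q-suc n (λ _ → + 1) ⟩
  (sumMap (λ _ → + 1) (Q n) + sumMap (λ _ → + 1) (Q n)) + sumMap (λ _ → + 1) (Q n)
    ≡⟨ cong (λ L → (L + L) + L) (trans (sumMap-one (Q n)) (cong +_ (length-Q n))) ⟩
  (+ 3 ℕ.^ n + + 3 ℕ.^ n) + + 3 ℕ.^ n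
    ≡⟨ cong +_ (triple (3 ℕ.^ n)) ⟩
  + 3 ℕ.^ suc n ∎)
  where open ≡-Reasoning

-- Sums of coordinatewise products factorise

-- A local weight assigns an integer to the states (a , a′), (b , b′), (c , c′)
-- of one coordinate of three pairs x, y, t.
LocalWeight : Set
LocalWeight = Bool → Bool → Bool → Bool → Bool → Bool → ℤ

weight : ∀ {n} → LocalWeight → Pair n → Pair n → Pair n → ℤ
weight φ ([] , []) ([] , []) ([] , []) = + 1
weight φ (a ∷ A , a′ ∷ A′) (b ∷ B , b′ ∷ B′) (c ∷ C , c′ ∷ C′) =
  φ a a′ b b′ c c′ * weight φ (A , A′) (B , B′) (C , C′)

localSum : LocalWeight → Bool → Bool → Bool → Bool → ℤ
localSum φ a a′ b b′ = (φ a a′ b b′ false false + φ a a′ b b′ false true) + φ a a′ b b′ true false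

productOfLocalSums : ∀ {n} → LocalWeight → Pair n → Pair n → ℤ
productOfLocalSums φ ([] , []) ([] , []) = + 1
productOfLocalSums φ (a ∷ A , a′ ∷ A′) (b ∷ B , b′ ∷ B′) =
  localSum φ a a′ b b′ * productOfLocalSums φ (A , A′) (B , B′)

sum-weight : ∀ n φ (x y : Pair n) → sumMap (weight φ x y) (Q n) ≡ productOfLocalSums φ x y
sum-weight zero φ ([] , []) ([] , []) = refl
sum-weight (suc n) φ (a ∷ A , a′ ∷ A′) (b ∷ B , b′ ∷ B′) = begin
  sumMap (weight φ (a ∷ A , a′ ∷ A′) (b ∷ B , b′ ∷ B′)) (Q (suc n))
    ≡⟨ sum-Q-suc n _ ⟩
  (sumMap (λ t → w₀₀ * rest t) (Q n) + sumMap (λ t → w₀₁ * rest t) (Q n))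
    + sumMap (λ t → w₁₀ * rest t) (Q n)
    ≡⟨ cong₂ _+_ (cong₂ _+_ (sumMap-* w₀₀ rest (Q n)) (sumMap-* w₀₁ rest (Q n))) (sumMap-* w₁₀ rest (Q n)) ⟩
  (w₀₀ * sumMap rest (Q n) + w₀₁ * sumMap rest (Q n)) + w₁₀ * sumMap rest (Q n)
    ≡⟨ cong (λ s → (w₀₀ * s + w₀₁ * s) + w₁₀ * s) (sum-weight n φ (A , A′) (B , B′)) ⟩
  (w₀₀ * P + w₀₁ * P) + w₁₀ * P
    ≡⟨ factor w₀₀ w₀₁ w₁₀ P ⟩
  localSum φ a a′ b b′ * P ∎
  where
  open ≡-Reasoning
  rest : Pair n → ℤ
  rest = weight φ (A , A′) (B , B′)
  P = productOfLocalSums φ (A , A′) (B , B′)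
  w₀₀ = φ a a′ b b′ false false
  w₀₁ = φ a a′ b b′ false true
  w₁₀ = φ a a′ b b′ true false
  factor : ∀ p q r s → (p * s + q * s) + r * s ≡ ((p + q) + r) * s
  factor = solve-∀

-- The product of chain Möbius functions

-- The position of a coordinate state in the chain (0,1) ⊏ (0,0) ⊏ (1,0).
rank₁ : Bool → Bool → ℕ
rank₁ true _ = 2
rank₁ false false = 1
rank₁ false true = 0

chainμ : ℕ → ℕ → ℤ
chainμ zero zero = + 1
chainμ zero (suc zero) = - (+ 1)
chainμ (suc i) (suc j) = chainμ i j
chainμ _ _ = + 0

μ₁ : Bool → Bool → Bool → Bool → ℤ
μ₁ a a′ c c′ = 𝟙 (le₁ a a′ c c′) * chainμ (rank₁ a a′) (rank₁ c c′)

μΠ : ∀ {n} → Pair n → Pair n → ℤ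
μΠ ([] , []) ([] , []) = + 1
μΠ (a ∷ A , a′ ∷ A′) (c ∷ C , c′ ∷ C′) = μ₁ a a′ c c′ * μΠ (A , A′) (C , C′)

μΠ-zero : ∀ {n} (x y : Pair n) → leᵇ x y ≡ false → μΠ x y ≡ + 0
μΠ-zero ([] , []) ([] , []) ()
μΠ-zero (a ∷ A , a′ ∷ A′) (c ∷ C , c′ ∷ C′) e = vanish (le₁ a a′ c c′) e
  where
  χ = chainμ (rank₁ a a′) (rank₁ c c′)
  rest = μΠ (A , A′) (C , C′)
  vanish : ∀ l → l ∧ leᵇ (A , A′) (C , C′) ≡ false → (𝟙 l * χ) * rest ≡ + 0
  vanish false _ = trans (cong (_* rest) (ℤP.*-zeroˡ χ)) (ℤP.*-zeroˡ rest)
  vanish true e = trans (cong ((𝟙 true * χ) *_) (μΠ-zero (A , A′) (C , C′) e)) (ℤP.*-zeroʳ (𝟙 true * χ))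

μΠ-refl : ∀ {n} (x : Pair n) → μΠ x x ≡ + 1
μΠ-refl ([] , []) = refl
μΠ-refl (a ∷ A , a′ ∷ A′) = cong₂ _*_ (μ₁-refl a a′) (μΠ-refl (A , A′))
  where
  μ₁-refl : ∀ a a′ → μ₁ a a′ a a′ ≡ + 1
  μ₁-refl true true = refl
  μ₁-refl true false = refl
  μ₁-refl false true = refl
  μ₁-refl false false = refl

LocalTest : Set
LocalTest = Bool → Bool → Bool → Bool → Bool → Bool → Bool

allᵇ : ∀ {n} → LocalTest → Pair n → Pair n → Pair n → Bool
allᵇ β ([] , []) ([] , []) ([] , []) = true
allᵇ β (a ∷ A , a′ ∷ A′) (b ∷ B , b′ ∷ B′) (c ∷ C , c′ ∷ C′) =
  β a a′ b b′ c c′ ∧ allᵇ β (A , A′) (B , B′) (C , C′)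

weight-test-μ : ∀ {n} (β : LocalTest) (x y t : Pair n) →
  weight (λ a a′ b b′ c c′ → 𝟙 (β a a′ b b′ c c′) * μ₁ a a′ c c′) x y t ≡ 𝟙 (allᵇ β x y t) * μΠ x t
weight-test-μ β ([] , []) ([] , []) ([] , []) = refl
weight-test-μ β (a ∷ A , a′ ∷ A′) (b ∷ B , b′ ∷ B′) (c ∷ C , c′ ∷ C′) = begin
  (𝟙 local * μ₁ a a′ c c′) * weight _ (A , A′) (B , B′) (C , C′)
    ≡⟨ cong ((𝟙 local * μ₁ a a′ c c′) *_) (weight-test-μ β (A , A′) (B , B′) (C , C′)) ⟩
  (𝟙 local * μ₁ a a′ c c′) * (𝟙 global * μΠ (A , A′) (C , C′))
    ≡⟨ regroup (𝟙 local) (μ₁ a a′ c c′) (𝟙 global) (μΠ (A , A′) (C , C′)) ⟩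
  (𝟙 local * 𝟙 global) * (μ₁ a a′ c c′ * μΠ (A , A′) (C , C′))
    ≡⟨ cong (_* μΠ (a ∷ A , a′ ∷ A′) (c ∷ C , c′ ∷ C′)) (sym (𝟙-∧ local global)) ⟩
  𝟙 (local ∧ global) * μΠ (a ∷ A , a′ ∷ A′) (c ∷ C , c′ ∷ C′) ∎
  where
  open ≡-Reasoning
  local = β a a′ b b′ c c′
  global = allᵇ β (A , A′) (B , B′) (C , C′)
  regroup : ∀ p m q r → (p * m) * (q * r) ≡ (p * q) * (m * r)
  regroup = solve-∀

-- μΠ satisfies the Möbius recursion

testWeight : LocalTest → LocalWeight
testWeight β a a′ b b′ c c′ = 𝟙 (β a a′ b b′ c c′) * μ₁ a a′ c c′

betweenTest : LocalTest
betweenTest a a′ b b′ c c′ = le₁ a a′ c c′ ∧ le₁ c c′ b b′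

endpointTest : LocalTest
endpointTest a a′ b b′ c c′ = le₁ a a′ c c′ ∧ (le₁ c c′ b b′ ∧ eq₁ c c′ b b′)

allᵇ-between : ∀ {n} (x y t : Pair n) → allᵇ betweenTest x y t ≡ leᵇ x t ∧ leᵇ t y
allᵇ-between ([] , []) ([] , []) ([] , []) = refl
allᵇ-between (a ∷ A , a′ ∷ A′) (b ∷ B , b′ ∷ B′) (c ∷ C , c′ ∷ C′) =
  trans (cong (betweenTest a a′ b b′ c c′ ∧_) (allᵇ-between (A , A′) (B , B′) (C , C′)))
        (∧-interchange (le₁ a a′ c c′) (le₁ c c′ b b′) _ _)

allᵇ-endpoint : ∀ {n} (x y t : Pair n) → allᵇ endpointTest x y t ≡ leᵇ x t ∧ (leᵇ t y ∧ eqᵇ t y)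
allᵇ-endpoint ([] , []) ([] , []) ([] , []) = refl
allᵇ-endpoint (a ∷ A , a′ ∷ A′) (b ∷ B , b′ ∷ B′) (c ∷ C , c′ ∷ C′) =
  trans (cong (endpointTest a a′ b b′ c c′ ∧_) (allᵇ-endpoint (A , A′) (B , B′) (C , C′)))
  (trans (∧-interchange (le₁ a a′ c c′) (le₁ c c′ b b′ ∧ eq₁ c c′ b b′) _ _)
         (cong ((le₁ a a′ c c′ ∧ leᵇ (A , A′) (C , C′)) ∧_)
               (∧-interchange (le₁ c c′ b b′) (eq₁ c c′ b b′) _ _)))

localSum-between : ∀ a a′ b b′ → not (a ∧ a′) ≡ true → not (b ∧ b′) ≡ true →
  localSum (testWeight betweenTest) a a′ b b′ ≡ 𝟙 (eq₁ a a′ b b′)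
localSum-between true true b b′ () _
localSum-between a a′ true true _ ()
localSum-between true false true false _ _ = refl
localSum-between true false false false _ _ = refl
localSum-between true false false true _ _ = refl
localSum-between false false true false _ _ = refl
localSum-between false false false false _ _ = refl
localSum-between false false false true _ _ = refl
localSum-between false true true false _ _ = refl
localSum-between false true false false _ _ = refl
localSum-between false true false true _ _ = refl

localSum-endpoint : ∀ a a′ b b′ → not (b ∧ b′) ≡ true →
  localSum (testWeight endpointTest) a a′ b b′ ≡ μ₁ a a′ b b′
localSum-endpoint a a′ true true ()
localSum-endpoint true true true false _ = refl
localSum-endpoint true true false false _ = refl
localSum-endpoint true true false true _ = refl
localSum-endpoint true false true false _ = refl
localSum-endpoint true false false false _ = refl
localSum-endpoint true false false true _ = refl
localSum-endpoint false false true false _ = refl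
localSum-endpoint false false false false _ = refl
localSum-endpoint false false false true _ = refl
localSum-endpoint false true true false _ = refl
localSum-endpoint false true false false _ = refl
localSum-endpoint false true false true _ = refl

between-sum : ∀ {n} (x y : Pair n) → validᵇ x ≡ true → validᵇ y ≡ true →
  sumMap (λ t → 𝟙 (leᵇ x t ∧ leᵇ t y) * μΠ x t) (Q n) ≡ 𝟙 (eqᵇ x y)
between-sum {n} x y vx vy = begin
  sumMap (λ t → 𝟙 (leᵇ x t ∧ leᵇ t y) * μΠ x t) (Q n)
    ≡⟨ sumMap-cong (Q n) as-weight ⟩
  sumMap (weight (testWeight betweenTest) x y) (Q n)
    ≡⟨ sum-weight n _ x y ⟩
  productOfLocalSums (testWeight betweenTest) x y
    ≡⟨ product-between x y vx vy ⟩
  𝟙 (eqᵇ x y) ∎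
  where
  open ≡-Reasoning
  as-weight : ∀ t → 𝟙 (leᵇ x t ∧ leᵇ t y) * μΠ x t ≡ weight (testWeight betweenTest) x y t
  as-weight t = sym (trans (weight-test-μ betweenTest x y t)
                           (cong (λ b → 𝟙 b * μΠ x t) (allᵇ-between x y t)))
  product-between : ∀ {m} (x y : Pair m) → validᵇ x ≡ true → validᵇ y ≡ true →
    productOfLocalSums (testWeight betweenTest) x y ≡ 𝟙 (eqᵇ x y)
  product-between ([] , []) ([] , []) _ _ = refl
  product-between (a ∷ A , a′ ∷ A′) (b ∷ B , b′ ∷ B′) vx vy
    with ∧-true {not (a ∧ a′)} vx | ∧-true {not (b ∧ b′)} vy
  ... | ha , va | hb , vb =
    trans (cong₂ _*_ (localSum-between a a′ b b′ ha hb) (product-between (A , A′) (B , B′) va vb))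
          (sym (𝟙-∧ (eq₁ a a′ b b′) _))

endpoint-sum : ∀ {n} (x y : Pair n) → validᵇ y ≡ true →
  sumMap (λ t → 𝟙 (leᵇ x t ∧ (leᵇ t y ∧ eqᵇ t y)) * μΠ x t) (Q n) ≡ μΠ x y
endpoint-sum {n} x y vy = begin
  sumMap (λ t → 𝟙 (leᵇ x t ∧ (leᵇ t y ∧ eqᵇ t y)) * μΠ x t) (Q n)
    ≡⟨ sumMap-cong (Q n) as-weight ⟩
  sumMap (weight (testWeight endpointTest) x y) (Q n)
    ≡⟨ sum-weight n _ x y ⟩
  productOfLocalSums (testWeight endpointTest) x y
    ≡⟨ product-endpoint x y vy ⟩
  μΠ x y ∎
  where
  open ≡-Reasoning
  as-weight : ∀ t → 𝟙 (leᵇ x t ∧ (leᵇ t y ∧ eqᵇ t y)) * μΠ x t ≡ weight (testWeight endpointTest) x y t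
  as-weight t = sym (trans (weight-test-μ endpointTest x y t)
                           (cong (λ b → 𝟙 b * μΠ x t) (allᵇ-endpoint x y t)))
  product-endpoint : ∀ {m} (x y : Pair m) → validᵇ y ≡ true →
    productOfLocalSums (testWeight endpointTest) x y ≡ μΠ x y
  product-endpoint ([] , []) ([] , []) _ = refl
  product-endpoint (a ∷ A , a′ ∷ A′) (b ∷ B , b′ ∷ B′) vy with ∧-true {not (b ∧ b′)} vy
  ... | hb , vb = cong₂ _*_ (localSum-endpoint a a′ b b′ hb) (product-endpoint (A , A′) (B , B′) vb)

strictlyBelow : ∀ {n} (x y t : Pair n) → Dec (x ⊑ t × t ⊏ y)
strictlyBelow x y t = (x ⊑? t) ×-dec (t ⊏? y)

μΠ-recursion : ∀ {n} (x y : Pair n) → validᵇ x ≡ true → validᵇ y ≡ true → ¬ x ≡ y →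
  - sumMap (μΠ x) (filter (strictlyBelow x y) (Q n)) ≡ μΠ x y
μΠ-recursion {n} x y vx vy x≢y = begin
  - sumMap (μΠ x) (filter (strictlyBelow x y) (Q n))
    ≡⟨ cong -_ (sumMap-filter (strictlyBelow x y) (μΠ x) (Q n)) ⟩
  - sumMap (λ t → 𝟙 (does (strictlyBelow x y t)) * μΠ x t) (Q n)
    ≡⟨ cong -_ (sumMap-cong (Q n) split) ⟩
  - sumMap (λ t → between t - endpoint t) (Q n)
    ≡⟨ cong -_ (sumMap-─ between endpoint (Q n)) ⟩
  - (sumMap between (Q n) - sumMap endpoint (Q n))
    ≡⟨ cong₂ (λ u v → - (u - v)) (between-sum x y vx vy) (endpoint-sum x y vy) ⟩
  - (𝟙 (eqᵇ x y) - μΠ x y)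
    ≡⟨ cong (λ b → - (𝟙 b - μΠ x y)) (false-of (eqᵇ x y) (eqᵇ-sound x y) x≢y) ⟩
  - (+ 0 - μΠ x y)
    ≡⟨ cong -_ (ℤP.+-identityˡ (- μΠ x y)) ⟩
  - - μΠ x y
    ≡⟨ ℤP.neg-involutive (μΠ x y) ⟩
  μΠ x y ∎
  where
  open ≡-Reasoning
  between endpoint : Pair n → ℤ
  between t = 𝟙 (leᵇ x t ∧ leᵇ t y) * μΠ x t
  endpoint t = 𝟙 (leᵇ x t ∧ (leᵇ t y ∧ eqᵇ t y)) * μΠ x t
  indicator-split : ∀ p q r (m : ℤ) → 𝟙 (p ∧ (q ∧ not r)) * m ≡ 𝟙 (p ∧ q) * m - 𝟙 (p ∧ (q ∧ r)) * m
  indicator-split false q r m = sym (ℤP.+-inverseʳ (+ 0 * m))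
  indicator-split true false r m = sym (ℤP.+-inverseʳ (+ 0 * m))
  indicator-split true true false m = sym (ℤP.+-identityʳ (+ 1 * m))
  indicator-split true true true m = sym (ℤP.+-inverseʳ (+ 1 * m))
  split : ∀ t → 𝟙 (does (strictlyBelow x y t)) * μΠ x t ≡ between t - endpoint t
  split t = trans (cong (λ b → 𝟙 b * μΠ x t) decided)
                  (indicator-split (leᵇ x t) (leᵇ t y) (eqᵇ t y) (μΠ x t))
    where
    decided : does (strictlyBelow x y t) ≡ leᵇ x t ∧ (leᵇ t y ∧ not (eqᵇ t y))
    decided = cong₂ _∧_ (does-⊑? x t) (cong₂ (λ u v → u ∧ not v) (does-⊑? t y) (does-≟P t y))

-- The fuelled recursion of Defs computes μΠ

rank : ∀ {n} → Pair n → ℕ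
rank ([] , []) = 0
rank (a ∷ A , a′ ∷ A′) = rank₁ a a′ ℕ.+ rank (A , A′)

rank₁-mono : ∀ a a′ c c′ → le₁ a a′ c c′ ≡ true → rank₁ a a′ ≤ rank₁ c c′
rank₁-mono true a′ true c′ _ = ℕP.≤-refl
rank₁-mono true a′ false c′ ()
rank₁-mono false true true c′ _ = z≤n
rank₁-mono false false true c′ _ = s≤s z≤n
rank₁-mono false true false c′ _ = z≤n
rank₁-mono false false false false _ = ℕP.≤-refl
rank₁-mono false false false true ()

rank₁-strict : ∀ a a′ c c′ → not (a ∧ a′) ≡ true → le₁ a a′ c c′ ≡ true → eq₁ a a′ c c′ ≡ false →
  rank₁ a a′ < rank₁ c c′
rank₁-strict true true c c′ () _ _
rank₁-strict true false true true _ () _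
rank₁-strict true false true false _ _ ()
rank₁-strict true false false c′ _ () _
rank₁-strict false false true true _ () _
rank₁-strict false false true false _ _ _ = s≤s (s≤s z≤n)
rank₁-strict false false false true _ () _
rank₁-strict false false false false _ _ ()
rank₁-strict false true true c′ _ _ _ = s≤s z≤n
rank₁-strict false true false true _ _ ()
rank₁-strict false true false false _ _ _ = s≤s z≤n

rank-mono : ∀ {n} (x y : Pair n) → leᵇ x y ≡ true → rank x ≤ rank y
rank-mono ([] , []) ([] , []) _ = z≤n
rank-mono (a ∷ A , a′ ∷ A′) (c ∷ C , c′ ∷ C′) e with ∧-true {le₁ a a′ c c′} e
... | head , tail = ℕP.+-mono-≤ (rank₁-mono a a′ c c′ head) (rank-mono (A , A′) (C , C′) tail)

-- Rank strictly increases along ⊏ in Q(N), so recursion on intervals terminates.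
rank-strict : ∀ {n} (x y : Pair n) → validᵇ x ≡ true → leᵇ x y ≡ true → eqᵇ x y ≡ false →
  rank x < rank y
rank-strict ([] , []) ([] , []) _ _ ()
rank-strict (a ∷ A , a′ ∷ A′) (c ∷ C , c′ ∷ C′) v e q
  with ∧-true {not (a ∧ a′)} v | ∧-true {le₁ a a′ c c′} e | eq₁ a a′ c c′ in local
... | ha , va | head , tail | false =
  ℕP.+-mono-<-≤ (rank₁-strict a a′ c c′ ha head local) (rank-mono (A , A′) (C , C′) tail)
... | ha , va | head , tail | true =
  ℕP.+-mono-≤-< (rank₁-mono a a′ c c′ head) (rank-strict (A , A′) (C , C′) va tail q)

rank<3^n : ∀ {n} (x : Pair n) → rank x < 3 ℕ.^ n
rank<3^n ([] , []) = s≤s z≤n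
rank<3^n {suc n} (a ∷ A , a′ ∷ A′) = begin-strict
  rank₁ a a′ ℕ.+ rank (A , A′)   <⟨ ℕP.+-monoʳ-< (rank₁ a a′) (rank<3^n (A , A′)) ⟩
  rank₁ a a′ ℕ.+ t               ≤⟨ ℕP.+-monoˡ-≤ t (ℕP.≤-trans (rank₁≤2 a a′) (ℕP.+-mono-≤ t≥1 t≥1)) ⟩
  (t ℕ.+ t) ℕ.+ t                ≡⟨ triple t ⟩
  3 ℕ.^ suc n                    ∎
  where
  open ℕP.≤-Reasoning
  t = 3 ℕ.^ n
  t≥1 : 1 ≤ t
  t≥1 = ℕP.≤-trans (s≤s z≤n) (rank<3^n (A , A′))
  rank₁≤2 : ∀ a a′ → rank₁ a a′ ≤ 2
  rank₁≤2 true _ = ℕP.≤-refl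
  rank₁≤2 false false = s≤s z≤n
  rank₁≤2 false true = z≤n

valid-of-∈Q : ∀ {n} {t : Pair n} → t ∈ Q n → validᵇ t ≡ true
valid-of-∈Q {n} {t} t∈Q with ∈-filter⁻ (λ p → Disjoint? (proj₁ p) (proj₂ p)) {xs = allPairs n} t∈Q
... | _ , disjoint = disjointᵇ-complete (proj₁ t) (proj₂ t) disjoint

mobiusFuel≡μΠ : ∀ {n} k (x y : Pair n) → validᵇ x ≡ true → validᵇ y ≡ true →
  rank y < k ℕ.+ rank x → mobiusFuel k x y ≡ μΠ x y
mobiusFuel≡μΠ zero x y vx vy bound with leᵇ x y in x⊑y
... | false = sym (μΠ-zero x y x⊑y)
... | true = ⊥-elim (ℕP.<-irrefl refl (ℕP.<-≤-trans bound (rank-mono x y x⊑y)))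
mobiusFuel≡μΠ {n} (suc k) x y vx vy bound with x ≟P y | x ⊑? y
... | yes refl | _ = sym (μΠ-refl x)
... | no x≢y | no x⋢y = sym (μΠ-zero x y (false-of (leᵇ x y) (leᵇ-sound x y) x⋢y))
... | no x≢y | yes _ = trans (cong -_ (sumMap-cong-∈ _ below)) (μΠ-recursion x y vx vy x≢y)
  where
  below : ∀ t → t ∈ filter (strictlyBelow x y) (Q n) → mobiusFuel k x t ≡ μΠ x t
  below t t∈ with ∈-filter⁻ (strictlyBelow x y) {xs = Q n} t∈
  ... | t∈Q , (_ , t⊑y , t≢y) = mobiusFuel≡μΠ k x t vx vt
          (ℕP.<-≤-trans (rank-strict t y vt (leᵇ-complete t y t⊑y) (false-of (eqᵇ t y) (eqᵇ-sound t y) t≢y))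
                        (s≤s⁻¹ bound))
    where
    vt = valid-of-∈Q t∈Q

mobius≡μΠ : ∀ {n} (x y : Pair n) → validᵇ x ≡ true → validᵇ y ≡ true → mobius x y ≡ μΠ x y
mobius≡μΠ {n} x y vx vy = mobiusFuel≡μΠ (length (Q n)) x y vx vy
  (ℕP.<-≤-trans (rank<3^n y)
    (ℕP.≤-trans (ℕP.≤-reflexive (sym (length-Q n))) (ℕP.m≤m+n (length (Q n)) (rank x))))

-- Evaluating μΠ: the closed form

sign : ∀ {n} → Pair n → Pair n → ℤ
sign (A , A′) (B , B′) = (- (+ 1)) ^ (∣ B ─ A ∣ ℕ.+ ∣ A′ ─ B′ ∣)

diff₁ : Bool → Bool → ℕ
diff₁ b a = ∣ (b ∷ []) ─ (a ∷ []) ∣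

sign₁ : Bool → Bool → Bool → Bool → ℤ
sign₁ a a′ b b′ = (- (+ 1)) ^ (diff₁ b a ℕ.+ diff₁ a′ b′)

closedForm : ∀ {n} → Pair n → Pair n → ℤ
closedForm (A , A′) (B , B′) = 𝟙 (leᵇ (A , A′) (B , B′) ∧ disjointᵇ A′ B) * sign (A , A′) (B , B′)

closed₁ : Bool → Bool → Bool → Bool → ℤ
closed₁ a a′ b b′ = 𝟙 (le₁ a a′ b b′ ∧ not (a′ ∧ b)) * sign₁ a a′ b b′

∣─∣-∷ : ∀ {n} b a (B A : Subset n) → ∣ (b ∷ B) ─ (a ∷ A) ∣ ≡ diff₁ b a ℕ.+ ∣ B ─ A ∣
∣─∣-∷ true true B A = refl
∣─∣-∷ true false B A = refl
∣─∣-∷ false true B A = refl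
∣─∣-∷ false false B A = refl

sign-∷ : ∀ {n} a a′ b b′ (A A′ B B′ : Subset n) →
  sign (a ∷ A , a′ ∷ A′) (b ∷ B , b′ ∷ B′) ≡ sign₁ a a′ b b′ * sign (A , A′) (B , B′)
sign-∷ a a′ b b′ A A′ B B′ = begin
  (- (+ 1)) ^ (∣ (b ∷ B) ─ (a ∷ A) ∣ ℕ.+ ∣ (a′ ∷ A′) ─ (b′ ∷ B′) ∣)
    ≡⟨ cong ((- (+ 1)) ^_) (cong₂ ℕ._+_ (∣─∣-∷ b a B A) (∣─∣-∷ a′ b′ A′ B′)) ⟩
  (- (+ 1)) ^ ((diff₁ b a ℕ.+ ∣ B ─ A ∣) ℕ.+ (diff₁ a′ b′ ℕ.+ ∣ A′ ─ B′ ∣))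
    ≡⟨ cong ((- (+ 1)) ^_) (ℕ-+-interchange (diff₁ b a) _ (diff₁ a′ b′) _) ⟩
  (- (+ 1)) ^ ((diff₁ b a ℕ.+ diff₁ a′ b′) ℕ.+ (∣ B ─ A ∣ ℕ.+ ∣ A′ ─ B′ ∣))
    ≡⟨ ℤP.^-distribˡ-+-* (- (+ 1)) (diff₁ b a ℕ.+ diff₁ a′ b′) _ ⟩
  sign₁ a a′ b b′ * sign (A , A′) (B , B′) ∎
  where open ≡-Reasoning

closedForm-∷ : ∀ {n} a a′ b b′ (A A′ B B′ : Subset n) →
  closedForm (a ∷ A , a′ ∷ A′) (b ∷ B , b′ ∷ B′) ≡ closed₁ a a′ b b′ * closedForm (A , A′) (B , B′)
closedForm-∷ a a′ b b′ A A′ B B′ = begin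
  𝟙 ((l ∧ L) ∧ (d ∧ D)) * sign (a ∷ A , a′ ∷ A′) (b ∷ B , b′ ∷ B′)
    ≡⟨ cong₂ _*_ (cong 𝟙 (∧-interchange l L d D)) (sign-∷ a a′ b b′ A A′ B B′) ⟩
  𝟙 ((l ∧ d) ∧ (L ∧ D)) * (sign₁ a a′ b b′ * sign (A , A′) (B , B′))
    ≡⟨ cong (_* (sign₁ a a′ b b′ * sign (A , A′) (B , B′))) (𝟙-∧ (l ∧ d) (L ∧ D)) ⟩
  (𝟙 (l ∧ d) * 𝟙 (L ∧ D)) * (sign₁ a a′ b b′ * sign (A , A′) (B , B′))
    ≡⟨ regroup (𝟙 (l ∧ d)) (𝟙 (L ∧ D)) (sign₁ a a′ b b′) (sign (A , A′) (B , B′)) ⟩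
  closed₁ a a′ b b′ * closedForm (A , A′) (B , B′) ∎
  where
  open ≡-Reasoning
  l = le₁ a a′ b b′
  L = leᵇ (A , A′) (B , B′)
  d = not (a′ ∧ b)
  D = disjointᵇ A′ B
  regroup : ∀ p q r s → (p * q) * (r * s) ≡ (p * r) * (q * s)
  regroup = solve-∀

μ₁-closed : ∀ a a′ b b′ → not (a ∧ a′) ≡ true → not (b ∧ b′) ≡ true → μ₁ a a′ b b′ ≡ closed₁ a a′ b b′
μ₁-closed true true b b′ () _
μ₁-closed a a′ true true _ ()
μ₁-closed true false true false _ _ = refl
μ₁-closed true false false false _ _ = refl
μ₁-closed true false false true _ _ = refl
μ₁-closed false false true false _ _ = refl
μ₁-closed false false false false _ _ = refl
μ₁-closed false false false true _ _ = refl
μ₁-closed false true true false _ _ = refl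
μ₁-closed false true false false _ _ = refl
μ₁-closed false true false true _ _ = refl

μΠ-closed : ∀ {n} (x y : Pair n) → validᵇ x ≡ true → validᵇ y ≡ true → μΠ x y ≡ closedForm x y
μΠ-closed ([] , []) ([] , []) _ _ = refl
μΠ-closed (a ∷ A , a′ ∷ A′) (b ∷ B , b′ ∷ B′) vx vy
  with ∧-true {not (a ∧ a′)} vx | ∧-true {not (b ∧ b′)} vy
... | ha , va | hb , vb =
  trans (cong₂ _*_ (μ₁-closed a a′ b b′ ha hb) (μΠ-closed (A , A′) (B , B′) va vb))
        (sym (closedForm-∷ a a′ b b′ A A′ B B′))

theorem2 : (n : ℕ) (A A′ B B′ : Subset n) →
    Disjoint A A′ → Disjoint B B′ →
    (((A , A′) ⊑ (B , B′) × Disjoint A′ B) →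
      mobius (A , A′) (B , B′) ≡ (- (+ 1)) ^ (∣ B ─ A ∣ ℕ.+ ∣ A′ ─ B′ ∣))
    × (¬ ((A , A′) ⊑ (B , B′) × Disjoint A′ B) →
      mobius (A , A′) (B , B′) ≡ + 0)
theorem2 n A A′ B B′ A∩A′≡∅ B∩B′≡∅ = comparable , incomparable
  where
  x = (A , A′)
  y = (B , B′)
  condition = leᵇ x y ∧ disjointᵇ A′ B
  mobius-closed : mobius x y ≡ 𝟙 condition * sign x y
  mobius-closed = trans (mobius≡μΠ x y vx vy) (μΠ-closed x y vx vy)
    where
    vx = disjointᵇ-complete A A′ A∩A′≡∅
    vy = disjointᵇ-complete B B′ B∩B′≡∅
  condition-sound : condition ≡ true → x ⊑ y × Disjoint A′ B
  condition-sound e with ∧-true {leᵇ x y} e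
  ... | x⊑y , A′∩B≡∅ = leᵇ-sound x y x⊑y , disjointᵇ-sound A′ B A′∩B≡∅
  comparable : x ⊑ y × Disjoint A′ B → mobius x y ≡ sign x y
  comparable (x⊑y , A′∩B≡∅) = trans mobius-closed
    (trans (cong (λ b → 𝟙 b * sign x y) (∧-intro (leᵇ-complete x y x⊑y) (disjointᵇ-complete A′ B A′∩B≡∅)))
           (ℤP.*-identityˡ (sign x y)))
  incomparable : ¬ (x ⊑ y × Disjoint A′ B) → mobius x y ≡ + 0
  incomparable fails = trans mobius-closed
    (trans (cong (λ b → 𝟙 b * sign x y) (false-of condition condition-sound fails))
           (ℤP.*-zeroˡ (sign x y)))
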